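{- For every $k\ge1$, with $n=3^k$ the number of variables, $\mathsf{D}_{\oplus}(\mathrm{MAJ}_3^{\otimes k})=\frac{n+1}{2}$.
   Context: $\mathrm{MAJ}_3\colon\{0,1\}^3\to\{ -1,1\}$ takes value $-1$ iff at least two inputs are $1$. The recursive majority $\mathrm{MAJ}_3^{\otimes k}$ on $n=3^k$ variables is defined by $\mathrm{MAJ}_3^{\otimes 1}=\mathrm{MAJ}_3$ and, for $k>1$, $\mathrm{MAJ}_3^{\otimes k}=\mathrm{MAJ}_3(\mathrm{MAJ}_3^{\otimes k-1},\mathrm{MAJ}_3^{\otimes k-1},\mathrm{MAJ}_3^{\otimes k-1})$, the three inner copies being applied to disjoint blocks of $3^{k-1}$ variables (outputs $-1$/$1$ fed to the outer $\mathrm{MAJ}_3$ as bits $1$/$0$). A parity decision tree is a rooted binary tree whose internal nodes are labeled by parities $\bigoplus_{i\in S}x_i$, with two outgoing edges labeled by the possible parity values, and leaves labeled by $-1$ or $1$; $\mathsf{D}_{\oplus}(f)$ is the minimal depth of such a tree computing $f$. -}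

module Defs where

open import Data.Bool using (Bool; true; false; _xor_; _∧_)
open import Data.Nat using (ℕ; zero; suc; _+_; _*_; _^_; _≤_; _⊔_)
open import Data.Vec using (Vec; []; _∷_; take; drop)
open import Relation.Binary.PropositionalEquality using (_≡_)

data PM : Set where
  -1' : PM
  +1' : PM

maj3 : Bool → Bool → Bool → PM
maj3 true  true  _     = -1'
maj3 true  false true  = -1'
maj3 false true  true  = -1'
maj3 _     _     _     = +1'

toBit : PM → Bool
toBit -1' = true
toBit +1' = false

-- Recursive majority MAJ₃^{⊗ k} on 3^k variables, for k ≥ 1 (index k here
-- means MAJ₃^{⊗ (suc k)}).
recMaj : (k : ℕ) → Vec Bool (3 ^ suc k) → PM
recMaj zero    (a ∷ b ∷ c ∷ []) = maj3 a b c
recMaj (suc k) x =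
  maj3 (toBit (recMaj k b₁)) (toBit (recMaj k b₂)) (toBit (recMaj k b₃))
  where
    m = 3 ^ suc k
    b₁ = take m x
    b₂ = take m (drop m x)
    b₃ = take m (drop m (drop m x))

-- Parity ⊕_{i ∈ S} x_i, with S ⊆ [n] given by its indicator vector.
parity : ∀ {n} → Vec Bool n → Vec Bool n → Bool
parity []       []       = false
parity (s ∷ ss) (x ∷ xs) = (s ∧ x) xor parity ss xs

data PDT (n : ℕ) : Set where
  leaf : PM → PDT n
  node : Vec Bool n → PDT n → PDT n → PDT n

depth : ∀ {n} → PDT n → ℕ
depth (leaf _)     = 0
depth (node _ l r) = suc (depth l ⊔ depth r)

eval : ∀ {n} → PDT n → Vec Bool n → PM
eval (leaf v)     x = v
eval (node S l r) x with parity S x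
... | false = eval l x
... | true  = eval r x

Computes : ∀ {n} → PDT n → (Vec Bool n → PM) → Set
Computes t f = ∀ x → eval t x ≡ f x

record IsParityDTDepth {n : ℕ} (f : Vec Bool n → PM) (d : ℕ) : Set where
  field
    witness    : PDT n
    computes   : Computes witness f
    depth≡     : depth witness ≡ d
    optimal    : ∀ (t : PDT n) → Computes t f → d ≤ depth t

-- If ⟨a,x⟩ = ⟨b,x⟩ then MAJ₃(⟨a,x⟩, ⟨b,x⟩, ⟨c,x⟩) = ⟨a,x⟩, and otherwise it is ⟨c,x⟩; so a
-- single query of a ⊕ b turns a MAJ₃ gate fed by three parities into one parity of the input.  Doing this for
-- the (n − 1)/2 gates of MAJ₃^{⊗k}, bottom-up, and finally querying the parity that carries the output gives a
-- tree of depth (n + 1)/2.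
--
-- If g : {0,1}ⁿ → ℤ is computed by a parity decision tree of depth d, every unnormalised Fourier
-- coefficient Σₓ g(x) (−1)^⟨S,x⟩ is divisible by 2^(n − d): twice the coefficient at S of a tree with root
-- query Q is a signed sum of the coefficients at S and S ⊕ Q of its two subtrees.  In ±1 notation
-- MAJ₃(a,b,c) = (a + b + c − abc)/2, and Σₓ (−1)^|x| = 0, so the coefficients C_k of MAJ₃^{⊗k} at the full set
-- satisfy 2 C_{k+1} = −C_k³, whence |C_k| = 2^((n + 1)/2).  The 0/1 indicator of the value −1 therefore has
-- coefficient ±2^((n − 1)/2) at the full set, which is only divisible by 2^(n − d) if d ≥ (n + 1)/2.

module Submission where

open import Defs
open import Data.Nat using (ℕ; suc; _+_; _^_; _/_)

open import Algebra using (CommutativeRing)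
open import Data.Bool using (Bool; true; false; _xor_; _∧_; not)
open import Data.Bool.Properties using (∧-distribʳ-xor; xor-assoc; xor-identityʳ; xor-∧-commutativeRing)
open import Data.Nat using (zero; _*_; _≤_; s≤s; s≤s⁻¹; z≤n; NonZero)
open import Data.Nat.DivMod using (m*n/n≡m)
open import Data.Nat.Properties
  using (+-comm; *-comm; +-suc; *-cancelˡ-≡; ≤-reflexive; ≤-trans; ≤-antisym; ≮⇒≥; n<1+n; +-monoˡ-≤
        ; m≤n⇒∃[o]m+o≡n; ⊔-lub; m≤m⊔n; m≤n⊔m; m^n≢0; ^-monoʳ-<; ^-distribˡ-+-*)
import Data.Nat.Tactic.RingSolver as ℕ-Solver
import Data.Nat.Divisibility as ℕ
open import Data.Nat.Divisibility using (>⇒∤)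
import Data.Integer as ℤ
open import Data.Integer using (ℤ; +_; -_; ∣_∣; 0ℤ)
import Data.Integer.Properties as ℤₚ
open import Data.Integer.Divisibility.Signed
  using (_∣_; ∣ᵤ⇒∣; ∣⇒∣ᵤ; ∣-refl; ∣-trans; ∣m∣n⇒∣m+n; ∣m∣n⇒∣m-n; ∣n⇒∣m*n; *-monoʳ-∣; *-cancelˡ-∣)
open import Data.Integer.Tactic.RingSolver using (solve-∀)
open import Data.Vec using (Vec; []; _∷_; _++_; take; drop; map; zipWith; replicate)
open import Data.Vec.Properties using (take-map; drop-map; map-∘)
open import Data.Product using (_,_)
open import Function using (_∘_)
open import Relation.Binary.PropositionalEquality
open import Algebra.Properties.CommutativeSemigroup
  (CommutativeRing.+-commutativeSemigroup xor-∧-commutativeRing) using (interchange)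

_⊕_ : ∀ {n} → Vec Bool n → Vec Bool n → Vec Bool n
_⊕_ = zipWith _xor_

parity-⊕ : ∀ {n} (S T x : Vec Bool n) → parity (S ⊕ T) x ≡ parity S x xor parity T x
parity-⊕ []      []      []      = refl
parity-⊕ (s ∷ S) (t ∷ T) (b ∷ x) = begin
  ((s xor t) ∧ b) xor parity (S ⊕ T) x
    ≡⟨ cong₂ _xor_ (∧-distribʳ-xor b s t) (parity-⊕ S T x) ⟩
  ((s ∧ b) xor (t ∧ b)) xor (parity S x xor parity T x)
    ≡⟨ interchange (s ∧ b) (t ∧ b) (parity S x) (parity T x) ⟩
  ((s ∧ b) xor parity S x) xor ((t ∧ b) xor parity T x) ∎
  where open ≡-Reasoning

-- Depth (n + 1)/2 suffices

maj3-agree : ∀ p q r → p xor q ≡ false → toBit (maj3 p q r) ≡ p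
maj3-agree false false r _ = refl
maj3-agree true  true  r _ = refl

maj3-disagree : ∀ p q r → p xor q ≡ true → toBit (maj3 p q r) ≡ r
maj3-disagree false true  false _ = refl
maj3-disagree false true  true  _ = refl
maj3-disagree true  false false _ = refl
maj3-disagree true  false true  _ = refl

eval-node-false : ∀ {n} S (l r : PDT n) x → parity S x ≡ false → eval (node S l r) x ≡ eval l x
eval-node-false S l r x S·x≡false rewrite S·x≡false = refl

eval-node-true : ∀ {n} S (l r : PDT n) x → parity S x ≡ true → eval (node S l r) x ≡ eval r x
eval-node-true S l r x S·x≡true rewrite S·x≡true = refl

majQuery : ∀ {n} (a b c : Vec Bool n) → (Vec Bool n → PDT n) → PDT n
majQuery a b c κ = node (a ⊕ b) (κ a) (κ c)

record Forwards {n} (v : Bool) (t : PDT n) (κ : Vec Bool n → PDT n) (x : Vec Bool n) : Set where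
  constructor forwards
  field
    query    : Vec Bool n
    parity≡  : parity query x ≡ v
    eval≡    : eval t x ≡ eval (κ query) x

forwards-then : ∀ {n v w x} {t : PDT n} {κ κ′ : Vec Bool n → PDT n} →
  Forwards v t κ x → (∀ ℓ → parity ℓ x ≡ v → Forwards w (κ ℓ) κ′ x) → Forwards w t κ′ x
forwards-then (forwards ℓ pℓ t≡κℓ) next with next ℓ pℓ
... | forwards ℓ′ pℓ′ κℓ≡κ′ℓ′ = forwards ℓ′ pℓ′ (trans t≡κℓ κℓ≡κ′ℓ′)

majQuery-forwards : ∀ {n} (a b c : Vec Bool n) κ x →
  Forwards (toBit (maj3 (parity a x) (parity b x) (parity c x))) (majQuery a b c κ) κ x
majQuery-forwards a b c κ x with parity (a ⊕ b) x in a⊕b·x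
... | false = forwards a (sym (maj3-agree _ _ _ (trans (sym (parity-⊕ a b x)) a⊕b·x)))
                         (eval-node-false (a ⊕ b) (κ a) (κ c) x a⊕b·x)
... | true  = forwards c (sym (maj3-disagree _ _ _ (trans (sym (parity-⊕ a b x)) a⊕b·x)))
                         (eval-node-true (a ⊕ b) (κ a) (κ c) x a⊕b·x)

majQuery-depth : ∀ {n D} (a b c : Vec Bool n) {κ} →
  (∀ ℓ → depth (κ ℓ) ≤ D) → depth (majQuery a b c κ) ≤ suc D
majQuery-depth a b c κ≤D = s≤s (⊔-lub (κ≤D a) (κ≤D c))

recMajTree : ∀ {n} k → Vec (Vec Bool n) (3 ^ suc k) → (Vec Bool n → PDT n) → PDT n
recMajTree zero    (a ∷ b ∷ c ∷ []) κ = majQuery a b c κ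
recMajTree (suc k) L                κ =
  recMajTree k (take m L)                 λ ℓ₁ →
  recMajTree k (take m (drop m L))        λ ℓ₂ →
  recMajTree k (take m (drop m (drop m L))) λ ℓ₃ →
  majQuery ℓ₁ ℓ₂ ℓ₃ κ
  where
  m : ℕ
  m = 3 ^ suc k

majGates : ℕ → ℕ
majGates zero    = 1
majGates (suc k) = suc (3 * majGates k)

recMajTree-depth : ∀ {n D} k L {κ : Vec Bool n → PDT n} →
  (∀ ℓ → depth (κ ℓ) ≤ D) → depth (recMajTree k L κ) ≤ majGates k + D
recMajTree-depth zero    (a ∷ b ∷ c ∷ []) κ≤D = majQuery-depth a b c κ≤D
recMajTree-depth {D = D} (suc k) L {κ} κ≤D =
  subst (depth (recMajTree (suc k) L κ) ≤_) (three-blocks (majGates k) D)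
    (recMajTree-depth k _ λ ℓ₁ → recMajTree-depth k _ λ ℓ₂ → recMajTree-depth k _ λ ℓ₃ →
      majQuery-depth ℓ₁ ℓ₂ ℓ₃ κ≤D)
  where
  three-blocks : ∀ g D → g + (g + (g + suc D)) ≡ suc (3 * g) + D
  three-blocks = ℕ-Solver.solve-∀

parities : ∀ {n m} → Vec (Vec Bool n) m → Vec Bool n → Vec Bool m
parities L x = map (λ S → parity S x) L

recMaj-suc-map : ∀ {A : Set} k (f : A → Bool) (L : Vec A (3 ^ suc (suc k))) →
  let m = 3 ^ suc k in
  recMaj (suc k) (map f L) ≡
  maj3 (toBit (recMaj k (map f (take m L))))
       (toBit (recMaj k (map f (take m (drop m L)))))
       (toBit (recMaj k (map f (take m (drop m (drop m L))))))
recMaj-suc-map k f L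
  rewrite drop-map f (3 ^ suc k) L | drop-map f (3 ^ suc k) (drop (3 ^ suc k) L)
        | take-map f (3 ^ suc k) L | take-map f (3 ^ suc k) (drop (3 ^ suc k) L)
        | take-map f (3 ^ suc k) (drop (3 ^ suc k) (drop (3 ^ suc k) L)) = refl

recMajTree-forwards : ∀ {n} k L (κ : Vec Bool n → PDT n) x →
  Forwards (toBit (recMaj k (parities L x))) (recMajTree k L κ) κ x
recMajTree-forwards zero    (a ∷ b ∷ c ∷ []) κ x = majQuery-forwards a b c κ x
recMajTree-forwards {n} (suc k) L κ x =
  forwards-then (recMajTree-forwards k L₁ κ₁ x) λ ℓ₁ p₁ →
  forwards-then (recMajTree-forwards k L₂ (κ₂ ℓ₁) x) λ ℓ₂ p₂ →
  forwards-then (recMajTree-forwards k L₃ (λ ℓ₃ → majQuery ℓ₁ ℓ₂ ℓ₃ κ) x) λ ℓ₃ p₃ →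
  subst (λ v → Forwards v (majQuery ℓ₁ ℓ₂ ℓ₃ κ) κ x) (majority ℓ₁ ℓ₂ ℓ₃ p₁ p₂ p₃)
    (majQuery-forwards ℓ₁ ℓ₂ ℓ₃ κ x)
  where
  m : ℕ
  m = 3 ^ suc k
  L₁ L₂ L₃ : Vec (Vec Bool n) m
  L₁ = take m L
  L₂ = take m (drop m L)
  L₃ = take m (drop m (drop m L))
  κ₂ : Vec Bool n → Vec Bool n → PDT n
  κ₂ ℓ₁ ℓ₂ = recMajTree k L₃ (λ ℓ₃ → majQuery ℓ₁ ℓ₂ ℓ₃ κ)
  κ₁ : Vec Bool n → PDT n
  κ₁ ℓ₁ = recMajTree k L₂ (κ₂ ℓ₁)
  output : Vec (Vec Bool n) m → Bool
  output B = toBit (recMaj k (parities B x))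
  majority : ∀ ℓ₁ ℓ₂ ℓ₃ → parity ℓ₁ x ≡ output L₁ → parity ℓ₂ x ≡ output L₂ → parity ℓ₃ x ≡ output L₃ →
    toBit (maj3 (parity ℓ₁ x) (parity ℓ₂ x) (parity ℓ₃ x)) ≡ toBit (recMaj (suc k) (parities L x))
  majority ℓ₁ ℓ₂ ℓ₃ p₁ p₂ p₃ rewrite p₁ | p₂ | p₃ | recMaj-suc-map k (λ S → parity S x) L = refl

basis : ∀ n → Vec (Vec Bool n) n
basis zero    = []
basis (suc n) = (true ∷ replicate n false) ∷ map (false ∷_) (basis n)

parity-zero : ∀ {n} (x : Vec Bool n) → parity (replicate n false) x ≡ false
parity-zero []      = refl
parity-zero (_ ∷ x) = parity-zero x

parities-basis : ∀ {n} (x : Vec Bool n) → parities (basis n) x ≡ x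
parities-basis         []      = refl
parities-basis {suc n} (b ∷ x) = cong₂ _∷_
  (trans (cong (b xor_) (parity-zero x)) (xor-identityʳ b))
  (trans (sym (map-∘ (λ S → parity S (b ∷ x)) (false ∷_) (basis n))) (parities-basis x))

answer : ∀ {n} → Vec Bool n → PDT n
answer ℓ = node ℓ (leaf +1') (leaf -1')

eval-answer : ∀ {n} (ℓ x : Vec Bool n) v → parity ℓ x ≡ toBit v → eval (answer ℓ) x ≡ v
eval-answer ℓ x -1' ℓ·x≡true  = eval-node-true ℓ _ _ x ℓ·x≡true
eval-answer ℓ x +1' ℓ·x≡false = eval-node-false ℓ _ _ x ℓ·x≡false

recMajPDT : ∀ k → PDT (3 ^ suc k)
recMajPDT k = recMajTree k (basis _) answer

recMajPDT-computes : ∀ k → Computes (recMajPDT k) (recMaj k)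
recMajPDT-computes k x with recMajTree-forwards k (basis _) answer x
... | forwards ℓ ℓ·x≡value eval≡ =
  trans eval≡ (eval-answer ℓ x _ (trans ℓ·x≡value (cong (toBit ∘ recMaj k) (parities-basis x))))

recMajPDT-depth : ∀ k → depth (recMajPDT k) ≤ suc (majGates k)
recMajPDT-depth k = subst (depth (recMajPDT k) ≤_) (+-comm (majGates k) 1)
  (recMajTree-depth k (basis _) λ ℓ → s≤s z≤n)

-- Sums over the Boolean cube and characters

cubeSum : ∀ {n} → (Vec Bool n → ℤ) → ℤ
cubeSum {zero}  f = f []
cubeSum {suc n} f = cubeSum (f ∘ (false ∷_)) ℤ.+ cubeSum (f ∘ (true ∷_))

cubeSum-cong : ∀ {n} {f g : Vec Bool n → ℤ} → (∀ x → f x ≡ g x) → cubeSum f ≡ cubeSum g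
cubeSum-cong {zero}  f≗g = f≗g []
cubeSum-cong {suc n} f≗g = cong₂ ℤ._+_ (cubeSum-cong (f≗g ∘ (false ∷_))) (cubeSum-cong (f≗g ∘ (true ∷_)))

cubeSum-+ : ∀ {n} (f g : Vec Bool n → ℤ) → cubeSum (λ x → f x ℤ.+ g x) ≡ cubeSum f ℤ.+ cubeSum g
cubeSum-+ {zero}  f g = refl
cubeSum-+ {suc n} f g = trans
  (cong₂ ℤ._+_ (cubeSum-+ (f ∘ (false ∷_)) (g ∘ (false ∷_))) (cubeSum-+ (f ∘ (true ∷_)) (g ∘ (true ∷_))))
  (interchange-+ (cubeSum (f ∘ (false ∷_))) (cubeSum (g ∘ (false ∷_))) (cubeSum (f ∘ (true ∷_))) (cubeSum (g ∘ (true ∷_))))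
  where
  interchange-+ : ∀ a b c d → (a ℤ.+ b) ℤ.+ (c ℤ.+ d) ≡ (a ℤ.+ c) ℤ.+ (b ℤ.+ d)
  interchange-+ = solve-∀

cubeSum-neg : ∀ {n} (f : Vec Bool n → ℤ) → cubeSum (λ x → - f x) ≡ - cubeSum f
cubeSum-neg {zero}  f = refl
cubeSum-neg {suc n} f = trans
  (cong₂ ℤ._+_ (cubeSum-neg (f ∘ (false ∷_))) (cubeSum-neg (f ∘ (true ∷_))))
  (sym (ℤₚ.neg-distrib-+ (cubeSum (f ∘ (false ∷_))) (cubeSum (f ∘ (true ∷_)))))

cubeSum-- : ∀ {n} (f g : Vec Bool n → ℤ) → cubeSum (λ x → f x ℤ.- g x) ≡ cubeSum f ℤ.- cubeSum g
cubeSum-- f g = trans (cubeSum-+ f (λ x → - g x)) (cong (λ s → cubeSum f ℤ.+ s) (cubeSum-neg g))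

cubeSum-*ˡ : ∀ {n} c (f : Vec Bool n → ℤ) → cubeSum (λ x → c ℤ.* f x) ≡ c ℤ.* cubeSum f
cubeSum-*ˡ {zero}  c f = refl
cubeSum-*ˡ {suc n} c f = trans
  (cong₂ ℤ._+_ (cubeSum-*ˡ c (f ∘ (false ∷_))) (cubeSum-*ˡ c (f ∘ (true ∷_))))
  (sym (ℤₚ.*-distribˡ-+ c (cubeSum (f ∘ (false ∷_))) (cubeSum (f ∘ (true ∷_)))))

cubeSum-++ : ∀ a {b} (f : Vec Bool (a + b) → ℤ) → cubeSum f ≡ cubeSum {a} (λ y → cubeSum {b} (λ z → f (y ++ z)))
cubeSum-++ zero    f = refl
cubeSum-++ (suc a) {b} f = cong₂ ℤ._+_ (cubeSum-++ a {b} (f ∘ (false ∷_))) (cubeSum-++ a {b} (f ∘ (true ∷_)))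

signed : Bool → ℤ
signed false = + 1
signed true  = - + 1

signed-xor : ∀ p q → signed (p xor q) ≡ signed p ℤ.* signed q
signed-xor false false = refl
signed-xor false true  = refl
signed-xor true  false = refl
signed-xor true  true  = refl

signed-not : ∀ p → signed (not p) ≡ - signed p
signed-not false = refl
signed-not true  = refl

χ : ∀ {n} → Vec Bool n → Vec Bool n → ℤ
χ S x = signed (parity S x)

-- Stated with signed (parity T x) rather than χ T x so that a case split on parity T x reduces it.
χ-⊕ : ∀ {n} (S T x : Vec Bool n) → χ (S ⊕ T) x ≡ χ S x ℤ.* signed (parity T x)
χ-⊕ S T x = trans (cong signed (parity-⊕ S T x)) (signed-xor (parity S x) (parity T x))

cubeSum-χ-true∷ : ∀ {n} (S : Vec Bool n) → cubeSum (χ (true ∷ S)) ≡ 0ℤ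
cubeSum-χ-true∷ S = begin
  cubeSum (χ S) ℤ.+ cubeSum (λ x → signed (not (parity S x)))
    ≡⟨ cong (λ s → cubeSum (χ S) ℤ.+ s) (trans (cubeSum-cong (signed-not ∘ parity S)) (cubeSum-neg (χ S))) ⟩
  cubeSum (χ S) ℤ.- cubeSum (χ S)
    ≡⟨ ℤₚ.+-inverseʳ (cubeSum (χ S)) ⟩
  0ℤ ∎
  where open ≡-Reasoning

2^n∣cubeSum-χ : ∀ {n} (S : Vec Bool n) → + (2 ^ n) ∣ cubeSum (χ S)
2^n∣cubeSum-χ []          = ∣-refl
2^n∣cubeSum-χ {suc n} (false ∷ S) =
  subst₂ _∣_ (sym (ℤₚ.pos-* 2 (2 ^ n))) (double (cubeSum (χ S))) (*-monoʳ-∣ (+ 2) (2^n∣cubeSum-χ S))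
  where
  double : ∀ s → + 2 ℤ.* s ≡ s ℤ.+ s
  double = solve-∀
2^n∣cubeSum-χ (true ∷ S) = subst (_ ∣_) (sym (cubeSum-χ-true∷ S)) (∣ᵤ⇒∣ (ℕ.divides 0 refl))

-- Granularity of the Fourier coefficients of a shallow tree

2^-mono-∣ : ∀ {a b} → a ≤ b → + (2 ^ a) ∣ + (2 ^ b)
2^-mono-∣ {a} a≤b with m≤n⇒∃[o]m+o≡n a≤b
... | o , refl = ∣ᵤ⇒∣ (ℕ.divides (2 ^ o) (trans (^-distribˡ-+-* 2 a o) (*-comm (2 ^ a) (2 ^ o))))

halve-∣ : ∀ {a z} → + (2 ^ suc a) ∣ + 2 ℤ.* z → + (2 ^ a) ∣ z
halve-∣ {a} 2^suc-a∣2z = *-cancelˡ-∣ (+ 2) (subst (_∣ _) (ℤₚ.pos-* 2 (2 ^ a)) 2^suc-a∣2z)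

fourier : ∀ {n} → (Vec Bool n → ℤ) → Vec Bool n → ℤ
fourier f S = cubeSum (λ x → f x ℤ.* χ S x)

fourier-node : ∀ {n} (val : PM → ℤ) Q (l r : PDT n) S →
  + 2 ℤ.* fourier (val ∘ eval (node Q l r)) S ≡
  (fourier (val ∘ eval l) S ℤ.+ fourier (val ∘ eval l) (S ⊕ Q)) ℤ.+
  (fourier (val ∘ eval r) S ℤ.- fourier (val ∘ eval r) (S ⊕ Q))
fourier-node {n} val Q l r S = begin
  + 2 ℤ.* fourier (val ∘ eval (node Q l r)) S
    ≡⟨ sym (cubeSum-*ˡ (+ 2) (λ x → val (eval (node Q l r) x) ℤ.* χ S x)) ⟩
  cubeSum (λ x → + 2 ℤ.* (val (eval (node Q l r) x) ℤ.* χ S x))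
    ≡⟨ cubeSum-cong pointwise ⟩
  cubeSum (λ x → (fₗ x ℤ.+ fₗ′ x) ℤ.+ (fᵣ x ℤ.- fᵣ′ x))
    ≡⟨ trans (cubeSum-+ (λ x → fₗ x ℤ.+ fₗ′ x) (λ x → fᵣ x ℤ.- fᵣ′ x))
             (cong₂ ℤ._+_ (cubeSum-+ fₗ fₗ′) (cubeSum-- fᵣ fᵣ′)) ⟩
  (fourier (val ∘ eval l) S ℤ.+ fourier (val ∘ eval l) (S ⊕ Q)) ℤ.+
  (fourier (val ∘ eval r) S ℤ.- fourier (val ∘ eval r) (S ⊕ Q)) ∎
  where
  open ≡-Reasoning
  vₗ vᵣ fₗ fₗ′ fᵣ fᵣ′ : Vec Bool n → ℤ
  vₗ = val ∘ eval l
  vᵣ = val ∘ eval r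
  fₗ  x = vₗ x ℤ.* χ S x
  fₗ′ x = vₗ x ℤ.* χ (S ⊕ Q) x
  fᵣ  x = vᵣ x ℤ.* χ S x
  fᵣ′ x = vᵣ x ℤ.* χ (S ⊕ Q) x
  branch-left : ∀ a b c → + 2 ℤ.* (a ℤ.* c) ≡
    (a ℤ.* c ℤ.+ a ℤ.* (c ℤ.* + 1)) ℤ.+ (b ℤ.* c ℤ.- b ℤ.* (c ℤ.* + 1))
  branch-left = solve-∀
  branch-right : ∀ a b c → + 2 ℤ.* (b ℤ.* c) ≡
    (a ℤ.* c ℤ.+ a ℤ.* (c ℤ.* - + 1)) ℤ.+ (b ℤ.* c ℤ.- b ℤ.* (c ℤ.* - + 1))
  branch-right = solve-∀
  pointwise : ∀ x → + 2 ℤ.* (val (eval (node Q l r) x) ℤ.* χ S x) ≡ (fₗ x ℤ.+ fₗ′ x) ℤ.+ (fᵣ x ℤ.- fᵣ′ x)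
  pointwise x rewrite χ-⊕ S Q x with parity Q x
  ... | false = branch-left  (vₗ x) (vᵣ x) (χ S x)
  ... | true  = branch-right (vₗ x) (vᵣ x) (χ S x)

descend : ∀ {d D a n} → d ≤ D → suc D + a ≤ n → d + suc a ≤ n
descend {d} {a = a} d≤D 1+D+a≤n = ≤-trans (≤-reflexive (+-suc d a)) (≤-trans (s≤s (+-monoˡ-≤ a d≤D)) 1+D+a≤n)

granularity : ∀ {n} (val : PM → ℤ) (t : PDT n) {a} → depth t + a ≤ n →
  ∀ S → + (2 ^ a) ∣ fourier (val ∘ eval t) S
granularity val (leaf v) a≤n S =
  subst (_ ∣_) (sym (cubeSum-*ˡ (val v) (χ S))) (∣n⇒∣m*n (val v) (∣-trans (2^-mono-∣ a≤n) (2^n∣cubeSum-χ S)))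
granularity val (node Q l r) {a} d+a≤n S =
  halve-∣ {a} (subst (_ ∣_) (sym (fourier-node val Q l r S))
    (∣m∣n⇒∣m+n (∣m∣n⇒∣m+n (IHₗ S) (IHₗ (S ⊕ Q))) (∣m∣n⇒∣m-n (IHᵣ S) (IHᵣ (S ⊕ Q)))))
  where
  IHₗ : ∀ S → + (2 ^ suc a) ∣ fourier (val ∘ eval l) S
  IHₗ = granularity val l (descend (m≤m⊔n (depth l) (depth r)) d+a≤n)
  IHᵣ : ∀ S → + (2 ^ suc a) ∣ fourier (val ∘ eval r) S
  IHᵣ = granularity val r (descend (m≤n⊔m (depth l) (depth r)) d+a≤n)

-- Fourier coefficients of MAJ₃^{⊗k} at the full set

full : ∀ n → Vec Bool n
full n = replicate n true

cubeSum-χ-full : ∀ n .{{_ : NonZero n}} → cubeSum (χ (full n)) ≡ 0ℤ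
cubeSum-χ-full (suc n) = cubeSum-χ-true∷ (full n)

χ-full-++ : ∀ {a b} (y : Vec Bool a) (z : Vec Bool b) → χ (full (a + b)) (y ++ z) ≡ χ (full a) y ℤ.* χ (full b) z
χ-full-++ {a} {b} y z = trans (cong signed (parity-full-++ y z)) (signed-xor (parity (full a) y) (parity (full b) z))
  where
  parity-full-++ : ∀ {a b} (y : Vec Bool a) (z : Vec Bool b) →
    parity (full (a + b)) (y ++ z) ≡ parity (full a) y xor parity (full b) z
  parity-full-++ []      z = refl
  parity-full-++ (c ∷ y) z = trans (cong (c xor_) (parity-full-++ y z)) (sym (xor-assoc c _ _))

take-++ : ∀ {A : Set} m {n} (y : Vec A m) (z : Vec A n) → take m (y ++ z) ≡ y
take-++ zero    []      z = refl
take-++ (suc m) (c ∷ y) z = cong (c ∷_) (take-++ m y z)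

drop-++ : ∀ {A : Set} m {n} (y : Vec A m) (z : Vec A n) → drop m (y ++ z) ≡ z
drop-++ zero    []      z = refl
drop-++ (suc m) (c ∷ y) z = drop-++ m y z

recMaj-++ : ∀ k (y₁ y₂ y₃ : Vec Bool (3 ^ suc k)) →
  recMaj (suc k) (y₁ ++ (y₂ ++ (y₃ ++ []))) ≡ maj3 (toBit (recMaj k y₁)) (toBit (recMaj k y₂)) (toBit (recMaj k y₃))
recMaj-++ k y₁ y₂ y₃
  rewrite drop-++ (3 ^ suc k) y₁ (y₂ ++ (y₃ ++ [])) | drop-++ (3 ^ suc k) y₂ (y₃ ++ [])
        | take-++ (3 ^ suc k) y₁ (y₂ ++ (y₃ ++ [])) | take-++ (3 ^ suc k) y₂ (y₃ ++ [])
        | take-++ (3 ^ suc k) y₃ [] = refl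

value : PM → ℤ
value v = signed (toBit v)

isMinus : PM → ℤ
isMinus -1' = + 1
isMinus +1' = 0ℤ

value-maj3 : ∀ p q r → + 2 ℤ.* value (maj3 p q r) ≡
  signed p ℤ.+ signed q ℤ.+ signed r ℤ.- signed p ℤ.* signed q ℤ.* signed r
value-maj3 false false false = refl
value-maj3 false false true  = refl
value-maj3 false true  false = refl
value-maj3 false true  true  = refl
value-maj3 true  false false = refl
value-maj3 true  false true  = refl
value-maj3 true  true  false = refl
value-maj3 true  true  true  = refl

majCoeff : ℕ → ℤ
majCoeff k = fourier (value ∘ recMaj k) (full (3 ^ suc k))

cubeSum-++₃ : ∀ m (f : Vec Bool (m + (m + (m + 0))) → ℤ) →
  cubeSum f ≡ cubeSum {m} (λ y₁ → cubeSum {m} (λ y₂ → cubeSum {m} (λ y₃ → f (y₁ ++ (y₂ ++ (y₃ ++ []))))))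
cubeSum-++₃ m f = trans (cubeSum-++ m {m + (m + 0)} f) (cubeSum-cong {m} λ y₁ →
  trans (cubeSum-++ m {m + 0} (λ w → f (y₁ ++ w))) (cubeSum-cong {m} λ y₂ →
  cubeSum-++ m {0} (λ w → f (y₁ ++ (y₂ ++ w)))))

cubeSum-collapse : ∀ {n} {g f : Vec Bool n → ℤ} → cubeSum g ≡ 0ℤ →
  ∀ a b → cubeSum (λ y → a ℤ.* g y ℤ.+ b ℤ.* f y) ≡ b ℤ.* cubeSum f
cubeSum-collapse {g = g} {f} Σg≡0 a b = begin
  cubeSum (λ y → a ℤ.* g y ℤ.+ b ℤ.* f y)
    ≡⟨ trans (cubeSum-+ (λ y → a ℤ.* g y) (λ y → b ℤ.* f y))
             (cong₂ ℤ._+_ (cubeSum-*ˡ a g) (cubeSum-*ˡ b f)) ⟩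
  a ℤ.* cubeSum g ℤ.+ b ℤ.* cubeSum f
    ≡⟨ cong (λ σ → a ℤ.* σ ℤ.+ b ℤ.* cubeSum f) Σg≡0 ⟩
  a ℤ.* 0ℤ ℤ.+ b ℤ.* cubeSum f
    ≡⟨ cong (ℤ._+ b ℤ.* cubeSum f) (ℤₚ.*-zeroʳ a) ⟩
  0ℤ ℤ.+ b ℤ.* cubeSum f
    ≡⟨ ℤₚ.+-identityˡ (b ℤ.* cubeSum f) ⟩
  b ℤ.* cubeSum f ∎
  where open ≡-Reasoning

2·value-recMaj-suc-χ : ∀ k (y₁ y₂ y₃ : Vec Bool (3 ^ suc k)) →
  let s : Vec Bool (3 ^ suc k) → ℤ
      s y = value (recMaj k y)
      c : Vec Bool (3 ^ suc k) → ℤ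
      c = χ (full (3 ^ suc k))
      y = y₁ ++ (y₂ ++ (y₃ ++ []))
  in + 2 ℤ.* (value (recMaj (suc k) y) ℤ.* χ (full (3 ^ suc (suc k))) y) ≡
     c y₁ ℤ.* c y₂ ℤ.* (s y₁ ℤ.+ s y₂) ℤ.* c y₃ ℤ.+ c y₁ ℤ.* c y₂ ℤ.* (+ 1 ℤ.- s y₁ ℤ.* s y₂) ℤ.* (s y₃ ℤ.* c y₃)
2·value-recMaj-suc-χ k y₁ y₂ y₃
  rewrite recMaj-++ k y₁ y₂ y₃
        | χ-full-++ {3 ^ suc k} y₁ (y₂ ++ (y₃ ++ []))
        | χ-full-++ {3 ^ suc k} y₂ (y₃ ++ [])
        | χ-full-++ {3 ^ suc k} y₃ [] = begin
  + 2 ℤ.* (value (maj3 b₁ b₂ b₃) ℤ.* (c₁ ℤ.* (c₂ ℤ.* (c₃ ℤ.* + 1))))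
    ≡⟨ reassociate (value (maj3 b₁ b₂ b₃)) c₁ c₂ c₃ ⟩
  + 2 ℤ.* value (maj3 b₁ b₂ b₃) ℤ.* (c₁ ℤ.* c₂ ℤ.* c₃)
    ≡⟨ cong (ℤ._* (c₁ ℤ.* c₂ ℤ.* c₃)) (value-maj3 b₁ b₂ b₃) ⟩
  (signed b₁ ℤ.+ signed b₂ ℤ.+ signed b₃ ℤ.- signed b₁ ℤ.* signed b₂ ℤ.* signed b₃) ℤ.* (c₁ ℤ.* c₂ ℤ.* c₃)
    ≡⟨ split-last (signed b₁) (signed b₂) (signed b₃) c₁ c₂ c₃ ⟩
  c₁ ℤ.* c₂ ℤ.* (signed b₁ ℤ.+ signed b₂) ℤ.* c₃ ℤ.+
  c₁ ℤ.* c₂ ℤ.* (+ 1 ℤ.- signed b₁ ℤ.* signed b₂) ℤ.* (signed b₃ ℤ.* c₃) ∎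
  where
  open ≡-Reasoning
  m : ℕ
  m = 3 ^ suc k
  b₁ b₂ b₃ : Bool
  b₁ = toBit (recMaj k y₁)
  b₂ = toBit (recMaj k y₂)
  b₃ = toBit (recMaj k y₃)
  c₁ c₂ c₃ : ℤ
  c₁ = χ (full m) y₁
  c₂ = χ (full m) y₂
  c₃ = χ (full m) y₃
  reassociate : ∀ v c₁ c₂ c₃ →
    + 2 ℤ.* (v ℤ.* (c₁ ℤ.* (c₂ ℤ.* (c₃ ℤ.* + 1)))) ≡ + 2 ℤ.* v ℤ.* (c₁ ℤ.* c₂ ℤ.* c₃)
  reassociate = solve-∀
  split-last : ∀ s₁ s₂ s₃ c₁ c₂ c₃ →
    (s₁ ℤ.+ s₂ ℤ.+ s₃ ℤ.- s₁ ℤ.* s₂ ℤ.* s₃) ℤ.* (c₁ ℤ.* c₂ ℤ.* c₃) ≡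
    c₁ ℤ.* c₂ ℤ.* (s₁ ℤ.+ s₂) ℤ.* c₃ ℤ.+ c₁ ℤ.* c₂ ℤ.* (+ 1 ℤ.- s₁ ℤ.* s₂) ℤ.* (s₃ ℤ.* c₃)
  split-last = solve-∀

majCoeff-suc : ∀ k → + 2 ℤ.* majCoeff (suc k) ≡ - (majCoeff k ℤ.* majCoeff k) ℤ.* majCoeff k
majCoeff-suc k = begin
  + 2 ℤ.* majCoeff (suc k)
    ≡⟨ sym (cubeSum-*ˡ (+ 2) h) ⟩
  cubeSum (λ x → + 2 ℤ.* h x)
    ≡⟨ cubeSum-++₃ m (λ x → + 2 ℤ.* h x) ⟩
  Σᵐ (λ y₁ → Σᵐ (λ y₂ → Σᵐ (λ y₃ → + 2 ℤ.* h (y₁ ++ (y₂ ++ (y₃ ++ []))))))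
    ≡⟨ cubeSum-cong {m} (λ y₁ → cubeSum-cong {m} λ y₂ → trans (cubeSum-cong (2·value-recMaj-suc-χ k y₁ y₂))
         (collapse (G y₁ ℤ.* G y₂ ℤ.* (s y₁ ℤ.+ s y₂)) (G y₁ ℤ.* G y₂ ℤ.* (+ 1 ℤ.- s y₁ ℤ.* s y₂)))) ⟩
  Σᵐ (λ y₁ → Σᵐ (λ y₂ → G y₁ ℤ.* G y₂ ℤ.* (+ 1 ℤ.- s y₁ ℤ.* s y₂) ℤ.* C))
    ≡⟨ cubeSum-cong {m} (λ y₁ →
         trans (cubeSum-cong (regroup₂ y₁)) (collapse (G y₁ ℤ.* C) (- (F y₁ ℤ.* C)))) ⟩
  Σᵐ (λ y₁ → - (F y₁ ℤ.* C) ℤ.* C)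
    ≡⟨ trans (cubeSum-cong regroup₁) (collapse 0ℤ (- (C ℤ.* C))) ⟩
  - (C ℤ.* C) ℤ.* C ∎
  where
  open ≡-Reasoning
  m : ℕ
  m = 3 ^ suc k
  C : ℤ
  C = majCoeff k
  Σᵐ : (Vec Bool m → ℤ) → ℤ
  Σᵐ = cubeSum
  h : Vec Bool (3 ^ suc (suc k)) → ℤ
  h x = value (recMaj (suc k) x) ℤ.* χ (full (3 ^ suc (suc k))) x
  s G F : Vec Bool m → ℤ
  s y = value (recMaj k y)
  G   = χ (full m)
  F y = s y ℤ.* G y
  collapse : ∀ a b → Σᵐ (λ y → a ℤ.* G y ℤ.+ b ℤ.* F y) ≡ b ℤ.* C
  collapse = cubeSum-collapse {g = G} {F} (cubeSum-χ-full m {{m^n≢0 3 (suc k)}})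
  regroup₂ : ∀ y₁ y₂ →
    G y₁ ℤ.* G y₂ ℤ.* (+ 1 ℤ.- s y₁ ℤ.* s y₂) ℤ.* C ≡ G y₁ ℤ.* C ℤ.* G y₂ ℤ.+ - (F y₁ ℤ.* C) ℤ.* F y₂
  regroup₂ y₁ y₂ = ring (s y₁) (s y₂) (G y₁) (G y₂) C
    where
    ring : ∀ s₁ s₂ c₁ c₂ C →
      c₁ ℤ.* c₂ ℤ.* (+ 1 ℤ.- s₁ ℤ.* s₂) ℤ.* C ≡ c₁ ℤ.* C ℤ.* c₂ ℤ.+ - (s₁ ℤ.* c₁ ℤ.* C) ℤ.* (s₂ ℤ.* c₂)
    ring = solve-∀
  regroup₁ : ∀ y₁ → - (F y₁ ℤ.* C) ℤ.* C ≡ 0ℤ ℤ.* G y₁ ℤ.+ - (C ℤ.* C) ℤ.* F y₁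
  regroup₁ y₁ = ring (s y₁) (G y₁) C
    where
    ring : ∀ s₁ c₁ C → - (s₁ ℤ.* c₁ ℤ.* C) ℤ.* C ≡ 0ℤ ℤ.* c₁ ℤ.+ - (C ℤ.* C) ℤ.* (s₁ ℤ.* c₁)
    ring = solve-∀

∣majCoeff∣ : ∀ k → ∣ majCoeff k ∣ ≡ 2 ^ suc (majGates k)
∣majCoeff∣ zero    = refl
∣majCoeff∣ (suc k) = *-cancelˡ-≡ _ _ 2 (begin
  2 * ∣ C′ ∣                      ≡⟨ ℤₚ.abs-* (+ 2) C′ ⟨
  ∣ + 2 ℤ.* C′ ∣                  ≡⟨ cong ∣_∣ (majCoeff-suc k) ⟩
  ∣ - (C ℤ.* C) ℤ.* C ∣           ≡⟨ ℤₚ.abs-* (- (C ℤ.* C)) C ⟩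
  ∣ - (C ℤ.* C) ∣ * ∣ C ∣         ≡⟨ cong (_* ∣ C ∣) (trans (ℤₚ.∣-i∣≡∣i∣ (C ℤ.* C)) (ℤₚ.abs-* C C)) ⟩
  ∣ C ∣ * ∣ C ∣ * ∣ C ∣           ≡⟨ cong (λ c → c * c * c) (∣majCoeff∣ k) ⟩
  2 ^ p * 2 ^ p * 2 ^ p           ≡⟨ cong (_* 2 ^ p) (^-distribˡ-+-* 2 p p) ⟨
  2 ^ (p + p) * 2 ^ p             ≡⟨ ^-distribˡ-+-* 2 (p + p) p ⟨
  2 ^ (p + p + p)                 ≡⟨ cong (2 ^_) (cube-exponent (majGates k)) ⟩
  2 * 2 ^ suc (majGates (suc k))  ∎)
  where
  open ≡-Reasoning
  C C′ : ℤ
  C  = majCoeff k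
  C′ = majCoeff (suc k)
  p : ℕ
  p  = suc (majGates k)
  cube-exponent : ∀ g → suc g + suc g + suc g ≡ suc (suc (suc (3 * g)))
  cube-exponent = ℕ-Solver.solve-∀

minusCoeff : ℕ → ℤ
minusCoeff k = fourier (isMinus ∘ recMaj k) (full (3 ^ suc k))

minusCoeff-majCoeff : ∀ k → + 2 ℤ.* minusCoeff k ≡ - majCoeff k
minusCoeff-majCoeff k = begin
  + 2 ℤ.* minusCoeff k
    ≡⟨ sym (cubeSum-*ˡ (+ 2) (λ x → isMinus (recMaj k x) ℤ.* G x)) ⟩
  cubeSum (λ x → + 2 ℤ.* (isMinus (recMaj k x) ℤ.* G x))
    ≡⟨ cubeSum-cong (λ x → isMinus-value (recMaj k x) (G x)) ⟩
  cubeSum (λ x → G x ℤ.- value (recMaj k x) ℤ.* G x)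
    ≡⟨ cubeSum-- G (λ x → value (recMaj k x) ℤ.* G x) ⟩
  cubeSum G ℤ.- majCoeff k
    ≡⟨ cong (ℤ._- majCoeff k) (cubeSum-χ-full (3 ^ suc k) {{m^n≢0 3 (suc k)}}) ⟩
  0ℤ ℤ.- majCoeff k
    ≡⟨ ℤₚ.+-identityˡ (- majCoeff k) ⟩
  - majCoeff k ∎
  where
  open ≡-Reasoning
  G : Vec Bool (3 ^ suc k) → ℤ
  G = χ (full (3 ^ suc k))
  isMinus-value : ∀ v c → + 2 ℤ.* (isMinus v ℤ.* c) ≡ c ℤ.- value v ℤ.* c
  isMinus-value -1' = solve-∀
  isMinus-value +1' = solve-∀

∣minusCoeff∣ : ∀ k → ∣ minusCoeff k ∣ ≡ 2 ^ majGates k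
∣minusCoeff∣ k = *-cancelˡ-≡ _ _ 2 (begin
  2 * ∣ minusCoeff k ∣          ≡⟨ ℤₚ.abs-* (+ 2) (minusCoeff k) ⟨
  ∣ + 2 ℤ.* minusCoeff k ∣      ≡⟨ cong ∣_∣ (minusCoeff-majCoeff k) ⟩
  ∣ - majCoeff k ∣              ≡⟨ ℤₚ.∣-i∣≡∣i∣ (majCoeff k) ⟩
  ∣ majCoeff k ∣                ≡⟨ ∣majCoeff∣ k ⟩
  2 * 2 ^ majGates k            ∎)
  where open ≡-Reasoning

-- Depth (n + 1)/2 is necessary

3^suc≡majGates+suc : ∀ k → 3 ^ suc k ≡ majGates k + suc (majGates k)
3^suc≡majGates+suc zero    = refl
3^suc≡majGates+suc (suc k) = trans (cong (3 *_) (3^suc≡majGates+suc k)) (triple (majGates k))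
  where
  triple : ∀ g → 3 * (g + suc g) ≡ suc (3 * g) + suc (suc (3 * g))
  triple = ℕ-Solver.solve-∀

recMaj-depth-lower : ∀ k (t : PDT (3 ^ suc k)) → Computes t (recMaj k) → suc (majGates k) ≤ depth t
recMaj-depth-lower k t t-computes = ≮⇒≥ λ shallow →
  >⇒∤ {{m^n≢0 2 g}} (^-monoʳ-< 2 (s≤s (s≤s z≤n)) (n<1+n g))
    (subst (2 ^ suc g ℕ.∣_) (∣minusCoeff∣ k) (∣⇒∣ᵤ (2^suc-g∣minusCoeff (s≤s⁻¹ shallow))))
  where
  g : ℕ
  g = majGates k
  2^suc-g∣minusCoeff : depth t ≤ g → + (2 ^ suc g) ∣ minusCoeff k
  2^suc-g∣minusCoeff depth≤g = subst (+ (2 ^ suc g) ∣_)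
    (cubeSum-cong (λ x → cong (λ v → isMinus v ℤ.* χ (full _) x) (t-computes x)))
    (granularity isMinus t (≤-trans (+-monoˡ-≤ (suc g) depth≤g) (≤-reflexive (sym (3^suc≡majGates+suc k))))
      (full _))

halfSize : ∀ k → (3 ^ suc k + 1) / 2 ≡ suc (majGates k)
halfSize k = trans (cong (λ n → (n + 1) / 2) (3^suc≡majGates+suc k))
  (trans (cong (_/ 2) (double (majGates k))) (m*n/n≡m (suc (majGates k)) 2))
  where
  double : ∀ g → g + suc g + 1 ≡ suc g * 2
  double = ℕ-Solver.solve-∀

theorem13 : ∀ (k : ℕ) → IsParityDTDepth (recMaj k) ((3 ^ suc k + 1) / 2)
theorem13 k = record
  { witness  = recMajPDT k
  ; computes = recMajPDT-computes k
  ; depth≡   = trans (≤-antisym (recMajPDT-depth k) (recMaj-depth-lower k _ (recMajPDT-computes k)))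
                     (sym (halfSize k))
  ; optimal  = λ t t-computes → subst (_≤ depth t) (sym (halfSize k)) (recMaj-depth-lower k t t-computes)
  }
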